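{- Let $W$ be the graph with vertex set $\{v',x,x',v'',y,y',w,w_1,w_2,w_3,w_4,w_5,w_6,a,b\}$ and edge set consisting of the triangles $\{v',x,x'\}$, $\{v'',y,y'\}$, $\{w_1,w_2,w_3\}$, $\{w_4,w_5,w_6\}$ together with the edges $xw_1,\ x'w,\ w_2w_5,\ w_3w_4,\ wa,\ w_6a,\ wb,\ w_1b,\ wy',\ w_6y$. Then there is a set $V'\subseteq V(W)$ with $a,b\notin V'$ and $|V'|=9$ covering all edges of $W$; and if a set $V'\subseteq V(W)$ covering all edges of $W$ contains at least one of $a,b$, then $|V'|\ge 10$, and such a set with $|V'|=10$ exists.
   Context: A set of vertices covers an edge if it contains at least one endpoint of that edge. -}

module Defs where

open import Data.Bool using (Bool; true; false; _∨_; T; if_then_else_)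
open import Data.Nat using (ℕ; zero; suc)
open import Data.List using (List; []; _∷_)
open import Data.Product using (_×_; _,_)
open import Data.List.Relation.Unary.All using (All)

data V : Set where
  v′ x x′ v″ y y′ w w₁ w₂ w₃ w₄ w₅ w₆ a b : V

allV : List V
allV = v′ ∷ x ∷ x′ ∷ v″ ∷ y ∷ y′ ∷ w ∷ w₁ ∷ w₂ ∷ w₃ ∷ w₄ ∷ w₅ ∷ w₆ ∷ a ∷ b ∷ []

edges : List (V × V)
edges =
  (v′ , x) ∷ (v′ , x′) ∷ (x , x′) ∷
  (v″ , y) ∷ (v″ , y′) ∷ (y , y′) ∷
  (w₁ , w₂) ∷ (w₁ , w₃) ∷ (w₂ , w₃) ∷
  (w₄ , w₅) ∷ (w₄ , w₆) ∷ (w₅ , w₆) ∷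
  (x , w₁) ∷ (x′ , w) ∷ (w₂ , w₅) ∷ (w₃ , w₄) ∷ (w , a) ∷
  (w₆ , a) ∷ (w , b) ∷ (w₁ , b) ∷ (w , y′) ∷ (w₆ , y) ∷ []

VSet : Set
VSet = V → Bool

count : VSet → List V → ℕ
count S [] = zero
count S (u ∷ us) = if S u then suc (count S us) else count S us

∣_∣ : VSet → ℕ
∣ S ∣ = count S allV

CoversEdge : VSet → V × V → Set
CoversEdge S (u , v) = T (S u ∨ S v)

Covers : VSet → Set
Covers S = All (CoversEdge S) edges

module Submission where

-- W contains the four vertex-disjoint triangles
--   {v′,x,x′}, {v″,y,y′}, {w₁,w₂,w₃}, {w₄,w₅,w₆},
-- and a vertex cover must take at least two vertices of every triangle.
-- The remaining vertices w, a, b are joined by the edges wa and wb; a cover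
-- that is required to contain a or b behaves as if the edge ab were present
-- too, so {w,a,b} acts as a fifth disjoint triangle and the cover has at
-- least 2·5 = 10 vertices.

open import Defs
open import Data.Bool using (Bool; true; false; _∨_; T)
open import Data.Bool.Properties using (T-∨; T-≡)
open import Data.Nat using (ℕ; suc; _+_; _*_; _≤_; z≤n; s≤s)
open import Data.Nat.Properties using (+-mono-≤)
open import Data.Nat.ListAction using (sum)
open import Data.List using (List; []; _∷_; _++_; concat; map; length)
open import Data.List.Relation.Unary.All using (All; []; _∷_; all?)
open import Data.Product using (_×_; Σ; _,_)
open import Data.Sum using (_⊎_; inj₁; inj₂)
import Data.Sum as Sum
open import Function.Bundles using (Equivalence)
open import Relation.Nullary.Decidable using (Dec; T?; toWitness)
open import Relation.Binary.PropositionalEquality using (_≡_; refl; cong; sym)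
open Relation.Binary.PropositionalEquality.≡-Reasoning

count-++ : (S : VSet) (us vs : List V) → count S (us ++ vs) ≡ count S us + count S vs
count-++ S []       vs = refl
count-++ S (u ∷ us) vs with S u
... | true  = cong suc (count-++ S us vs)
... | false = count-++ S us vs

count-concat : (S : VSet) (blocks : List (List V)) →
               count S (concat blocks) ≡ sum (map (count S) blocks)
count-concat S []            = refl
count-concat S (us ∷ blocks) = begin
  count S (us ++ concat blocks)             ≡⟨ count-++ S us (concat blocks) ⟩
  count S us + count S (concat blocks)      ≡⟨ cong (count S us +_) (count-concat S blocks) ⟩
  count S us + sum (map (count S) blocks)   ∎

count-move : (S : VSet) (us : List V) (u : V) (vs : List V) →
             count S (us ++ u ∷ vs) ≡ count S (u ∷ us ++ vs)
count-move S []        u vs = refl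
count-move S (u′ ∷ us) u vs with S u′ | S u | count-move S us u vs
... | true  | true  | ih = cong suc ih
... | true  | false | ih = cong suc ih
... | false | _     | ih = ih

triangles : List (List V)
triangles = (v′ ∷ x ∷ x′ ∷ []) ∷ (v″ ∷ y ∷ y′ ∷ []) ∷
            (w₁ ∷ w₂ ∷ w₃ ∷ []) ∷ (w₄ ∷ w₅ ∷ w₆ ∷ []) ∷ []

hub : List V
hub = w ∷ a ∷ b ∷ []

blocks : List (List V)
blocks = triangles ++ hub ∷ []

-- The five blocks partition V(W), so ∣ S ∣ is the sum of the block counts.
-- In allV the hub w sits between y′ and w₁; it is moved next to a and b.
size-by-blocks : (S : VSet) → ∣ S ∣ ≡ sum (map (count S) blocks)
size-by-blocks S = begin
  count S (before ++ w ∷ after)        ≡⟨ count-move S before w after ⟩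
  count S (w ∷ before ++ after)        ≡⟨ sym (count-move S (concat triangles) w (a ∷ b ∷ [])) ⟩
  count S (concat blocks)              ≡⟨ count-concat S blocks ⟩
  sum (map (count S) blocks)           ∎
  where
  before after : List V
  before = v′ ∷ x ∷ x′ ∷ v″ ∷ y ∷ y′ ∷ []
  after  = w₁ ∷ w₂ ∷ w₃ ∷ w₄ ∷ w₅ ∷ w₆ ∷ a ∷ b ∷ []

triangle-needs-two : (S : VSet) (p q r : V) →
  T (S p ∨ S q) → T (S p ∨ S r) → T (S q ∨ S r) → 2 ≤ count S (p ∷ q ∷ r ∷ [])
triangle-needs-two S p q r pq pr qr with S p | S q | S r
... | true  | true  | _     = s≤s (s≤s z≤n)
... | true  | false | true  = s≤s (s≤s z≤n)
... | false | true  | true  = s≤s (s≤s z≤n)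
triangle-needs-two S p q r pq pr () | true  | false | false
triangle-needs-two S p q r pq () qr | false | true  | false
triangle-needs-two S p q r () pr qr | false | false | _

sum-lower-bound : (k : ℕ) (ns : List ℕ) → All (k ≤_) ns → length ns * k ≤ sum ns
sum-lower-bound k []       []       = z≤n
sum-lower-bound k (n ∷ ns) (k≤n ∷ ks) = +-mono-≤ k≤n (sum-lower-bound k ns ks)

-- "a or b lies in S" is exactly the cover condition for the (absent) edge ab.
a-or-b : {p q : Bool} → p ≡ true ⊎ q ≡ true → T (p ∨ q)
a-or-b h = Equivalence.from T-∨ (Sum.map (Equivalence.from T-≡) (Equivalence.from T-≡) h)

cover-with-a-or-b : (S : VSet) → Covers S → T (S a ∨ S b) → 10 ≤ ∣ S ∣
cover-with-a-or-b S
  (v′x ∷ v′x′ ∷ xx′ ∷ v″y ∷ v″y′ ∷ yy′ ∷ w₁w₂ ∷ w₁w₃ ∷ w₂w₃ ∷ w₄w₅ ∷ w₄w₆ ∷ w₅w₆ ∷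
   _ ∷ _ ∷ _ ∷ _ ∷ wa ∷ _ ∷ wb ∷ _) ab
  rewrite size-by-blocks S =
  sum-lower-bound 2 (map (count S) blocks)
    ( triangle-needs-two S v′ x x′ v′x v′x′ xx′
    ∷ triangle-needs-two S v″ y y′ v″y v″y′ yy′
    ∷ triangle-needs-two S w₁ w₂ w₃ w₁w₂ w₁w₃ w₂w₃
    ∷ triangle-needs-two S w₄ w₅ w₆ w₄w₅ w₄w₆ w₅w₆
    ∷ triangle-needs-two S w a b wa wb ab
    ∷ [])

covers? : (S : VSet) → Dec (Covers S)
covers? S = all? (λ { (u , v) → T? (S u ∨ S v) }) edges

-- A cover of size 9 avoiding a and b: two vertices from each triangle plus w.
cover₉ : VSet
cover₉ x′ = false
cover₉ y′ = false
cover₉ w₂ = false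
cover₉ w₄ = false
cover₉ a  = false
cover₉ b  = false
cover₉ _  = true

cover₁₀ : VSet
cover₁₀ a = true
cover₁₀ u = cover₉ u

mainTheorem7 :
    (Σ VSet λ S → Covers S × S a ≡ false × S b ≡ false × ∣ S ∣ ≡ 9)
    × ((S : VSet) → Covers S → (S a ≡ true ⊎ S b ≡ true) → 10 ≤ ∣ S ∣)
    × (Σ VSet λ S → Covers S × (S a ≡ true ⊎ S b ≡ true) × ∣ S ∣ ≡ 10)
mainTheorem7 =
    (cover₉ , toWitness {a? = covers? cover₉} _ , refl , refl , refl)
  , (λ S cov ab → cover-with-a-or-b S cov (a-or-b ab))
  , (cover₁₀ , toWitness {a? = covers? cover₁₀} _ , inj₁ refl , refl)
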